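{- Let $P=P(G,[\omega])$ be a toric poset over a finite simple graph $G=(V,E)$, and let $I\subseteq V$. If $I=[i,j]^{\mathrm{tor}}$ is a toric interval of $P$ for some $i,j\in V$, then there exists $\omega'\in[\omega]$ such that $I$ equals the interval $[i,j]=\{k\in V: i\le k\le j\}$ of the ordinary poset $P(G,\omega')$. The converse need not hold: there exist $G$, $\omega$, $\omega'\in[\omega]$ and $i,j$ such that the interval $[i,j]$ of $P(G,\omega')$ is not a toric interval of $P(G,[\omega])$.
   Context: $P(G,\omega')$ is the poset on $V$ with $a\le b$ iff there is a directed path from $a$ to $b$ in $\omega'$. Toric equivalence of acyclic orientations is generated by converting a source into a sink; $[\omega]$ is the class of $\omega$. Representing coordinates of $\mathbb{R}^V/\mathbb{Z}^V$ in $[0,1)$, the toric chamber $c(P)$ is the set of $x$ with $x_a\neq x_b$ for $\{a,b\}\in E$ whose orientation (edge $a\to b$ iff $x_a<x_b$) lies in $[\omega]$. A subset $C=\{i_1,\dots,i_m\}$ is a toric chain of $P$ if there is a cyclic class $[(i_1,\dots,i_m)]$ (set of cyclic shifts) such that for every $x\in c(P)$ some $(j_1,\dots,j_m)$ in it has $0\le x_{j_1}<\dots<x_{j_m}<1$; write $P|_C$ for this class. Toric interval: $[i,i]^{\mathrm{tor}}=\{i\}$; for $i\ne j$, $[i,j]^{\mathrm{tor}}=\varnothing$ if $i,j$ lie on no common toric chain, and otherwise $[i,j]^{\mathrm{tor}}=\{i,j\}\cup\{k:\{i,j,k\}$ is a toric chain with $P|_{\{i,j,k\}}=[(i,k,j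)]\}$.
   Formalization: The toric chamber $c(P)$ consists of points with rational coordinates in [0,1) rather than points of $\mathbb{R}^V/\mathbb{Z}^V$. -}

module Defs where

open import Data.Nat using (ℕ)
open import Data.Fin using (Fin; _≟_)
open import Data.Bool using (Bool; true; false; _∧_; if_then_else_; _∨_)
open import Data.List using (List; []; _∷_; drop; take; _++_)
open import Data.List.Membership.Propositional using (_∈_)
open import Data.List.Relation.Unary.Unique.Propositional using (Unique)
open import Data.List.Relation.Unary.Linked using (Linked)
open import Data.Rational using (ℚ; 0ℚ; 1ℚ; _≤_; _<_)
open import Data.Rational.Properties using (_<?_)
open import Data.Product using (Σ; ∃; _×_; _,_)
open import Data.Sum using (_⊎_)
open import Relation.Nullary using (¬_)
open import Relation.Nullary.Decidable using (⌊_⌋)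
open import Relation.Binary.PropositionalEquality using (_≡_; _≢_)
open import Relation.Binary.Construct.Closure.ReflexiveTransitive using (Star)
open import Function.Bundles using (_⇔_)

record Graph (n : ℕ) : Set where
  field
    adj     : Fin n → Fin n → Bool
    adj-sym : ∀ a b → adj a b ≡ adj b a
    irrefl  : ∀ a → adj a a ≡ false
open Graph public

Orient : ℕ → Set
Orient n = Fin n → Fin n → Bool

record IsOrientation {n : ℕ} (G : Graph n) (ω : Orient n) : Set where
  field
    on-edges : ∀ a b → ω a b ≡ true → adj G a b ≡ true
    total    : ∀ a b → adj G a b ≡ true → ω a b ≡ true ⊎ ω b a ≡ true
    antisym  : ∀ a b → ω a b ≡ true → ω b a ≡ false

Arrow : ∀ {n} → Orient n → Fin n → Fin n → Set
Arrow ω a b = ω a b ≡ true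

Le : ∀ {n} → Orient n → Fin n → Fin n → Set
Le ω = Star (Arrow ω)

Acyclic : ∀ {n} → Orient n → Set
Acyclic ω = ∀ a b → Arrow ω a b → ¬ Le ω b a

IsSource : ∀ {n} → Orient n → Fin n → Set
IsSource ω v = ∀ a → ω a v ≡ false

isV : ∀ {n} → Fin n → Fin n → Bool
isV v a = ⌊ a ≟ v ⌋

flipAt : ∀ {n} → Fin n → Orient n → Orient n
flipAt v ω a b = if isV v a ∨ isV v b then ω b a else ω a b

Flip : ∀ {n} → Orient n → Orient n → Set
Flip ω ω' = Σ _ λ v → IsSource ω v × (∀ a b → ω' a b ≡ flipAt v ω a b)

data _∼tor_ {n : ℕ} : Orient n → Orient n → Set where
  same   : ∀ {ω ω'} → (∀ a b → ω a b ≡ ω' a b) → ω ∼tor ω'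
  flip   : ∀ {ω ω'} → Flip ω ω' → ω ∼tor ω'
  sym    : ∀ {ω ω'} → ω ∼tor ω' → ω' ∼tor ω
  trans  : ∀ {ω ω' ω''} → ω ∼tor ω' → ω' ∼tor ω'' → ω ∼tor ω''

orientOf : ∀ {n} → Graph n → (Fin n → ℚ) → Orient n
orientOf G x a b = adj G a b ∧ ⌊ x a <? x b ⌋

-- the toric chamber c(P) for P = P(G,[ω]), points taken in [0,1)^V
-- (rational coordinates)
InChamber : ∀ {n} → Graph n → Orient n → (Fin n → ℚ) → Set
InChamber G ω x =
  (∀ a → 0ℚ ≤ x a × x a < 1ℚ) ×
  (∀ a b → adj G a b ≡ true → x a ≢ x b) ×
  (orientOf G x ∼tor ω)

rotate : ∀ {A : Set} → ℕ → List A → List A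
rotate k l = drop k l ++ take k l

CycOrd : ∀ {n} → Graph n → Orient n → List (Fin n) → Set
CycOrd G ω l = ∀ x → InChamber G ω x →
  Σ ℕ λ k → Linked (λ a b → x a < x b) (rotate k l)

CommonChain : ∀ {n} → Graph n → Orient n → Fin n → Fin n → Set
CommonChain G ω i j = Σ (List (Fin _)) λ l →
  Unique l × i ∈ l × j ∈ l × CycOrd G ω l

InTorInterval : ∀ {n} → Graph n → Orient n → Fin n → Fin n → Fin n → Set
InTorInterval G ω i j k =
  (i ≡ j × k ≡ i) ⊎
  (i ≢ j × CommonChain G ω i j ×
    (k ≡ i ⊎ k ≡ j ⊎ (k ≢ i × k ≢ j × CycOrd G ω (i ∷ k ∷ j ∷ []))))

InInterval : ∀ {n} → Orient n → Fin n → Fin n → Fin n → Set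
InInterval ω' i j k = Le ω' i k × Le ω' k j

IsTorInterval : ∀ {n} → Graph n → Orient n → (Fin n → Set) → Fin n → Fin n → Set
IsTorInterval G ω I i j = ∀ k → I k ⇔ InTorInterval G ω i j k

IsInterval : ∀ {n} → Orient n → (Fin n → Set) → Fin n → Fin n → Set
IsInterval ω' I i j = ∀ k → I k ⇔ InInterval ω' i j k

{-# OPTIONS --safe #-}
-- Reversing every edge between the up-set of a vertex u and its complement is a sequence of
-- source-to-sink flips (flip the minimal elements of the up-set one at a time), and it makes u a
-- source.  So for i ≠ j we may pass to some ω′ ∈ [ω] in which i is a source.
--
-- If i ≤ j in ω′ and some arrow i → b has j ≤ b, then [i,j]^tor = [i,j].  Along the flips leading
-- from ω′ to the orientation of a chamber point x, count how often each vertex is flipped; the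
-- lifts K = x − r then increase along the arrows of ω′ and K_b < K_i + 1, so every k ∈ [i,j] has
-- K_i < K_k < K_j < K_i + 1, i.e. (i,k,j) is a toric chain.  Conversely, if k ∉ [i,j], a height
-- function of ω′ raised above i (or above k) gives a chamber point violating the cyclic order (i,k,j).
--
-- If i ≰ j, a height function taking the same value at i and j shows that i and j lie on no common
-- toric chain, so both intervals are empty.  If i ≤ j but no arrow i → b has j ≤ b, reversing the
-- up-set of j as well keeps i a source and makes j one, so i ≰ j in the new orientation.
--
-- For the converse, in the path 0 → 1 → 2 the point (0, ½, 0) lies in the chamber, so 0 and 2 lie
-- on no common toric chain and [0,2] = V is not a toric interval.
module Submission where

open import Defs
open import Data.Nat using (ℕ)
open import Data.Fin using (Fin)
open import Data.Product using (Σ; _×_)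
open import Relation.Nullary using (¬_)

open import Data.Bool using (Bool; true; false; _∧_; _∨_; _xor_; not; if_then_else_)
import Data.Bool.Properties as 𝔹
open import Data.Empty using (⊥; ⊥-elim)
open import Data.Fin as F using (zero; suc; _≟_)
open import Data.Fin.Properties using (any?; all?; pigeonhole)
open import Data.Fin.Subset using (∣_∣) renaming (_∈_ to _∈ₛ_)
open import Data.Fin.Subset.Properties using (p⊂q⇒∣p∣<∣q∣; ∣p∣≤n; Empty-unique; ∣⊥∣≡0)
open import Data.Nat as ℕ using (zero; suc; _+_; _≤_; _<_; z≤n; s≤s)
import Data.Nat.Properties as ℕ
open import Data.Product using (∃; _,_; proj₁; proj₂; map₁)
open import Data.Integer as ℤ using (ℤ; 0ℤ; 1ℤ; +_)
import Data.Integer.Properties as ℤ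
open import Data.Rational as ℚ using (ℚ; 0ℚ; 1ℚ)
import Data.Rational.Properties as ℚ
import Data.Rational.Unnormalised as ℚᵘ
import Data.Rational.Unnormalised.Properties as ℚᵘ
open import Data.Integer.Tactic.RingSolver using (solve-∀)
open import Data.Sum using (_⊎_; inj₁; inj₂)
import Data.Sum
open import Data.List using (List; []; _∷_; drop; take)
open import Data.List.Membership.Propositional using (_∈_)
open import Data.List.Properties using (take++drop≡id; drop-[]; take-[])
open import Data.List.Relation.Binary.Permutation.Propositional using (_↭_)
import Data.List.Relation.Binary.Permutation.Propositional.Properties as ↭
import Data.List.Relation.Binary.Permutation.Propositional as ↭
import Data.List.Relation.Unary.All as All
open import Data.List.Relation.Unary.AllPairs using (AllPairs; []; _∷_)
open import Data.List.Relation.Unary.Any using (here; there)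
open import Data.List.Relation.Unary.Linked using (Linked; []; [-]; _∷_)
open import Data.List.Relation.Unary.Linked.Properties using (Linked⇒AllPairs)
open import Data.Vec using (tabulate)
open import Data.Vec.Properties using (lookup∘tabulate; lookup⇒[]=; []=⇒lookup)
open import Function using (_∘_; Equivalence; _⇔_; mk⇔)
import Function.Properties.Equivalence as ⇔
open import Relation.Binary.Construct.Closure.ReflexiveTransitive using (ε; _◅_; _◅◅_)
open import Relation.Binary.PropositionalEquality as ≡
  using (_≡_; _≢_; refl; cong; cong₂; subst)
open import Relation.Nullary using (Dec; yes; no; contradiction)
open import Relation.Nullary.Decidable
  using (⌊_⌋; True; isYes≗does; toWitness; dec-true; dec-false; map′; ¬?; _→-dec_; _⊎-dec_; _×-dec_)

module _ {A : Set} (a? : Dec A) where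

  ⌊⌋-true : A → ⌊ a? ⌋ ≡ true
  ⌊⌋-true a = ≡.trans (isYes≗does a?) (dec-true a? a)

  ⌊⌋-false : ¬ A → ⌊ a? ⌋ ≡ false
  ⌊⌋-false ¬a = ≡.trans (isYes≗does a?) (dec-false a? ¬a)

  ⌊⌋-sound : ⌊ a? ⌋ ≡ true → A
  ⌊⌋-sound e = toWitness {a? = a?} (Equivalence.from 𝔹.T-≡ e)

count : ∀ {n} → (Fin n → Bool) → ℕ
count f = ∣ tabulate f ∣

_⊆ᵇ_ : ∀ {n} → (Fin n → Bool) → (Fin n → Bool) → Set
f ⊆ᵇ g = ∀ {z} → f z ≡ true → g z ≡ true

module _ {n} (f : Fin n → Bool) where

  ∈-tabulate⁺ : ∀ {x} → f x ≡ true → x ∈ₛ tabulate f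
  ∈-tabulate⁺ {x} fx = lookup⇒[]= x (tabulate f) (≡.trans (lookup∘tabulate f x) fx)

  ∈-tabulate⁻ : ∀ {x} → x ∈ₛ tabulate f → f x ≡ true
  ∈-tabulate⁻ {x} x∈f = ≡.trans (≡.sym (lookup∘tabulate f x)) ([]=⇒lookup x∈f)

count-≤ : ∀ {n} (f : Fin n → Bool) → count f ≤ n
count-≤ f = ∣p∣≤n (tabulate f)

count-mono-< : ∀ {n} {f g : Fin n → Bool} {m} → f ⊆ᵇ g → f m ≡ false → g m ≡ true →
               count f < count g
count-mono-< {f = f} {g} f⊆g fm gm =
  p⊂q⇒∣p∣<∣q∣ ((∈-tabulate⁺ g ∘ f⊆g ∘ ∈-tabulate⁻ f) , _ , ∈-tabulate⁺ g gm ,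
                λ m∈f → 𝔹.not-¬ fm (∈-tabulate⁻ f m∈f))

count-empty : ∀ {n} {f : Fin n → Bool} → (∀ z → f z ≡ false) → count f ≡ 0
count-empty {n} {f} f≡false = ≡.trans (cong ∣_∣ (Empty-unique f-empty)) (∣⊥∣≡0 n)
  where f-empty = λ (z , z∈f) → 𝔹.not-¬ (f≡false z) (∈-tabulate⁻ f z∈f)

count-nonempty : ∀ {n} {f : Fin n → Bool} {m} → f m ≡ true → 0 < count f
count-nonempty {n} {f} fm = subst (_< count f) (count-empty {n} {λ _ → false} λ _ → refl)
                           (count-mono-< {n} {λ _ → false} {f} (λ ()) refl fm)

module Reachability {n} (ω : Orient n) where

  pathLength : ∀ {a b} → Le ω a b → ℕ
  pathLength ε       = 0
  pathLength (_ ◅ p) = suc (pathLength p)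

  vertex : ∀ {a b} (p : Le ω a b) → Fin (suc (pathLength p)) → Fin n
  vertex {a} ε       _       = a
  vertex {a} (_ ◅ p) zero    = a
  vertex     (_ ◅ p) (suc t) = vertex p t

  Le-vertex : ∀ {a b} (p : Le ω a b) t → Le ω a (vertex p t)
  Le-vertex ε       _       = ε
  Le-vertex (_ ◅ p) zero    = ε
  Le-vertex (e ◅ p) (suc t) = e ◅ Le-vertex p t

  vertex-< : ∀ {a b} (p : Le ω a b) {s t} → s F.< t →
             ∃ λ c → Arrow ω (vertex p s) c × Le ω c (vertex p t)
  vertex-< ε       {zero}  {zero}  ()
  vertex-< (e ◅ p) {zero}  {suc t} _         = _ , e , Le-vertex p t
  vertex-< (_ ◅ p) {suc s} {suc t} (s≤s s<t) = vertex-< p s<t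

  pathLength-< : Acyclic ω → ∀ {a b} (p : Le ω a b) → pathLength p < n
  pathLength-< acy p with pathLength p ℕ.<? n
  ... | yes p<n = p<n
  ... | no p≮n with pigeonhole (s≤s (ℕ.≮⇒≥ p≮n)) (vertex p)
  ... | s , t , s<t , vs≡vt with vertex-< p s<t
  ... | c , e , c≤vt = ⊥-elim (acy _ _ e (subst (Le ω c) (≡.sym vs≡vt) c≤vt))

  LeWithin : ℕ → Fin n → Fin n → Set
  LeWithin zero    a b = a ≡ b
  LeWithin (suc k) a b = a ≡ b ⊎ ∃ λ c → Arrow ω a c × LeWithin k c b

  leWithin? : ∀ k a b → Dec (LeWithin k a b)
  leWithin? zero    a b = a ≟ b
  leWithin? (suc k) a b =
    (a ≟ b) ⊎-dec any? (λ c → (ω a c 𝔹.≟ true) ×-dec leWithin? k c b)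

  LeWithin⇒Le : ∀ k {a b} → LeWithin k a b → Le ω a b
  LeWithin⇒Le zero    refl                 = ε
  LeWithin⇒Le (suc k) (inj₁ refl)          = ε
  LeWithin⇒Le (suc k) (inj₂ (_ , e , p)) = e ◅ LeWithin⇒Le k p

  Le⇒LeWithin : ∀ {k a b} (p : Le ω a b) → pathLength p ≤ k → LeWithin k a b
  Le⇒LeWithin {zero}  ε       _         = refl
  Le⇒LeWithin {suc k} ε       _         = inj₁ refl
  Le⇒LeWithin {suc k} (e ◅ p) (s≤s p≤k) = inj₂ (_ , e , Le⇒LeWithin p p≤k)

  Le? : Acyclic ω → ∀ a b → Dec (Le ω a b)
  Le? acy a b = map′ (LeWithin⇒Le n) (λ p → Le⇒LeWithin p (ℕ.<⇒≤ (pathLength-< acy p)))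
                     (leWithin? n a b)

Monotone : ∀ {n} → Orient n → (Fin n → ℕ) → Set
Monotone ω f = ∀ {a b} → Arrow ω a b → f a < f b

module _ {n} {ω : Orient n} {f : Fin n → ℕ} (mono : Monotone ω f) where

  monotone-≤ : ∀ {a b} → Le ω a b → f a ≤ f b
  monotone-≤ ε       = ℕ.≤-refl
  monotone-≤ (e ◅ p) = ℕ.<⇒≤ (ℕ.<-≤-trans (mono e) (monotone-≤ p))

  monotone-< : ∀ {a b} → Le ω a b → a ≢ b → f a < f b
  monotone-< ε       a≢a = contradiction refl a≢a
  monotone-< (e ◅ p) _   = ℕ.<-≤-trans (mono e) (monotone-≤ p)

  monotone⇒acyclic : Acyclic ω
  monotone⇒acyclic a b e p = ℕ.<-irrefl refl (ℕ.<-≤-trans (mono e) (monotone-≤ p))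

source-minimal : ∀ {n} {ω : Orient n} {v z} → IsSource ω v → Le ω z v → z ≡ v
source-minimal source ε = refl
source-minimal {z = z} source (z→c ◅ c≤v) with source-minimal source c≤v
... | refl = contradiction z→c (𝔹.not-¬ (source z))

acyclic-antisym : ∀ {n} {ω : Orient n} → Acyclic ω → ∀ {a b} → Le ω a b → Le ω b a → a ≡ b
acyclic-antisym acy ε         _   = refl
acyclic-antisym acy (a→c ◅ c≤b) b≤a = contradiction (c≤b ◅◅ b≤a) (acy _ _ a→c)

Upset : ∀ {n} → Orient n → (Fin n → Bool) → Set
Upset ω U = ∀ {a b} → Arrow ω a b → U a ≡ true → U b ≡ true

module Heights {n} {ω : Orient n} (acy : Acyclic ω) where
  open Reachability ω using (Le?)

  _≤ᵇ_ : Fin n → Fin n → Bool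
  a ≤ᵇ b = ⌊ Le? acy a b ⌋

  ≤ᵇ-complete : ∀ {a b} → Le ω a b → a ≤ᵇ b ≡ true
  ≤ᵇ-complete = ⌊⌋-true (Le? acy _ _)

  ≤ᵇ-false : ∀ {a b} → ¬ Le ω a b → a ≤ᵇ b ≡ false
  ≤ᵇ-false = ⌊⌋-false (Le? acy _ _)

  ≤ᵇ-sound : ∀ {a b} → a ≤ᵇ b ≡ true → Le ω a b
  ≤ᵇ-sound = ⌊⌋-sound (Le? acy _ _)

  ≤ᵇ-upset : ∀ u → Upset ω (u ≤ᵇ_)
  ≤ᵇ-upset u e u≤a = ≤ᵇ-complete (≤ᵇ-sound u≤a ◅◅ e ◅ ε)

  height : (Fin n → Bool) → Fin n → ℕ
  height S w = count (λ z → z ≤ᵇ w ∧ S z)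

  height-≤ : ∀ S w → height S w ≤ n
  height-≤ S w = count-≤ _

  height-monotone : ∀ {S} → (∀ {a b} → Arrow ω a b → S b ≡ true) → Monotone ω (height S)
  height-monotone {S} head∈S {a} {b} e = count-mono-< {m = b} below-a⊆below-b b≰a b≤b
    where
    below-a⊆below-b : (λ z → z ≤ᵇ a ∧ S z) ⊆ᵇ (λ z → z ≤ᵇ b ∧ S z)
    below-a⊆below-b {z} z∈ rewrite ≤ᵇ-upset z e (𝔹.∧-conicalˡ _ _ z∈) =
      𝔹.∧-conicalʳ _ _ z∈
    b≰a : (b ≤ᵇ a ∧ S b) ≡ false
    b≰a rewrite ≤ᵇ-false (acy a b e) = refl
    b≤b : (b ≤ᵇ b ∧ S b) ≡ true
    b≤b rewrite ≤ᵇ-complete {b} ε = head∈S e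

  depth : Fin n → ℕ
  depth = height (λ _ → true)

  depth-monotone : Monotone ω depth
  depth-monotone = height-monotone λ _ → refl

  depth-positive : ∀ w → 0 < depth w
  depth-positive w = count-nonempty {f = λ z → z ≤ᵇ w ∧ true} {m = w} w≤w
    where
    w≤w : (w ≤ᵇ w ∧ true) ≡ true
    w≤w rewrite ≤ᵇ-complete {w} ε = refl

  raiseAbove : Fin n → ℕ → (Fin n → ℕ) → Fin n → ℕ
  raiseAbove u c f w = f w + (if u ≤ᵇ w then c else 0)

  raiseAbove-monotone : ∀ {f} u c → Monotone ω f → Monotone ω (raiseAbove u c f)
  raiseAbove-monotone u c mono {a} {b} e = ℕ.+-mono-<-≤ (mono e) bonus-mono
    where
    bonus-mono : (if u ≤ᵇ a then c else 0) ≤ (if u ≤ᵇ b then c else 0)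
    bonus-mono with u ≤ᵇ a in u≤a
    ... | true  rewrite ≤ᵇ-upset u e u≤a = ℕ.≤-refl
    ... | false = z≤n

  raiseAbove-≤ : ∀ {f d} u c → (∀ w → f w ≤ d) → ∀ w → raiseAbove u c f w ≤ d + c
  raiseAbove-≤ u c f≤d w = ℕ.+-mono-≤ (f≤d w) (bonus≤c (u ≤ᵇ w))
    where
    bonus≤c : ∀ b → (if b then c else 0) ≤ c
    bonus≤c true  = ℕ.≤-refl
    bonus≤c false = z≤n

  raiseAbove-above : ∀ {f u w} c → Le ω u w → raiseAbove u c f w ≡ f w + c
  raiseAbove-above c u≤w rewrite ≤ᵇ-complete u≤w = refl

  raiseAbove-notAbove : ∀ {f u w} c → ¬ Le ω u w → raiseAbove u c f w ≡ f w
  raiseAbove-notAbove {f} {w = w} c u≰w rewrite ≤ᵇ-false u≰w = ℕ.+-identityʳ (f w)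

_≐_ : ∀ {n} → Orient n → Orient n → Set
ω ≐ ω' = ∀ a b → ω a b ≡ ω' a b

SymmetricBool : ∀ {n} → (Fin n → Fin n → Bool) → Set
SymmetricBool c = ∀ a b → c a b ≡ c b a

reverseWhere : ∀ {n} → (Fin n → Fin n → Bool) → Orient n → Orient n
reverseWhere c ω a b = if c a b then ω b a else ω a b

reverseWhere-inverse : ∀ {n} {c : Fin n → Fin n → Bool} {ω ω'} → SymmetricBool c →
                       ω' ≐ reverseWhere c ω → ω ≐ reverseWhere c ω'
reverseWhere-inverse {c = c} c-sym ω'≐ a b rewrite ω'≐ a b | ω'≐ b a | c-sym b a with c a b
... | true  = refl
... | false = refl

module _ {n} (G : Graph n) where

  orientation-cong : ∀ {ω ω'} → ω ≐ ω' → IsOrientation G ω → IsOrientation G ω'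
  orientation-cong {ω} {ω'} ω≐ω' o = record
    { on-edges = λ a b e → on-edges a b (≡.trans (ω≐ω' a b) e)
    ; total    = λ a b ab →
        Data.Sum.map (≡.trans (≡.sym (ω≐ω' a b))) (≡.trans (≡.sym (ω≐ω' b a))) (total a b ab)
    ; antisym  = λ a b e → ≡.trans (≡.sym (ω≐ω' b a)) (antisym a b (≡.trans (ω≐ω' a b) e))
    }
    where open IsOrientation o

  reverseWhere-orientation : ∀ {c ω} → SymmetricBool c → IsOrientation G ω →
                             IsOrientation G (reverseWhere c ω)
  reverseWhere-orientation {c} {ω} c-sym o = record
    { on-edges = on-edges′ ; total = total′ ; antisym = antisym′ }
    where
    open IsOrientation o
    on-edges′ : ∀ a b → reverseWhere c ω a b ≡ true → adj G a b ≡ true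
    on-edges′ a b e with c a b
    ... | true  = ≡.trans (adj-sym G a b) (on-edges b a e)
    ... | false = on-edges a b e
    total′ : ∀ a b → adj G a b ≡ true →
             reverseWhere c ω a b ≡ true ⊎ reverseWhere c ω b a ≡ true
    total′ a b ab rewrite c-sym b a with c a b
    ... | true  = Data.Sum.swap (total a b ab)
    ... | false = total a b ab
    antisym′ : ∀ a b → reverseWhere c ω a b ≡ true → reverseWhere c ω b a ≡ false
    antisym′ a b e rewrite c-sym b a with c a b
    ... | true  = antisym b a e
    ... | false = antisym a b e

  flipAt-orientation : ∀ {ω} v → IsOrientation G ω → IsOrientation G (flipAt v ω)
  flipAt-orientation v = reverseWhere-orientation λ a b → 𝔹.∨-comm (isV v a) (isV v b)

  ∼tor-orientation : ∀ {ω ω'} → ω ∼tor ω' → IsOrientation G ω ⇔ IsOrientation G ω'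
  ∼tor-orientation (same ω≐ω') =
    mk⇔ (orientation-cong ω≐ω') (orientation-cong (λ a b → ≡.sym (ω≐ω' a b)))
  ∼tor-orientation (flip (v , _ , ω'≐)) =
    mk⇔ (orientation-cong (λ a b → ≡.sym (ω'≐ a b)) ∘ flipAt-orientation v)
        (orientation-cong (λ a b → ≡.sym (flipBack a b)) ∘ flipAt-orientation v)
    where flipBack = reverseWhere-inverse (λ a b → 𝔹.∨-comm (isV v a) (isV v b)) ω'≐
  ∼tor-orientation (sym p)     = ⇔.sym (∼tor-orientation p)
  ∼tor-orientation (trans p q) = ⇔.trans (∼tor-orientation p) (∼tor-orientation q)

reverseCut : ∀ {n} → (Fin n → Bool) → Orient n → Orient n
reverseCut U = reverseWhere (λ a b → U a xor U b)

reverseCut-orientation : ∀ {n} {G : Graph n} {ω} U → IsOrientation G ω →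
                         IsOrientation G (reverseCut U ω)
reverseCut-orientation {G = G} U = reverseWhere-orientation G λ a b → 𝔹.xor-comm (U a) (U b)

module _ {n} {ω : Orient n} {U : Fin n → Bool} where

  reverseCut-minimal-source : Upset ω U → ∀ {v} → U v ≡ true →
                              (∀ {a} → U a ≡ true → ω a v ≡ false) →
                              IsSource (reverseCut U ω) v
  reverseCut-minimal-source up {v} Uv minimal a rewrite Uv with U a in Ua
  ... | true  = minimal Ua
  ... | false = 𝔹.¬-not λ v→a → 𝔹.not-¬ Ua (up v→a Uv)

  reverseCut-source : ∀ {v} → IsSource ω v → U v ≡ false →
                      (∀ {b} → Arrow ω v b → U b ≡ false) → IsSource (reverseCut U ω) v
  reverseCut-source {v} source Uv outside a rewrite Uv with U a in Ua
  ... | true  = 𝔹.¬-not λ v→a → 𝔹.not-¬ (outside v→a) Ua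
  ... | false = source a

  reverseCut-identity : (∀ z → U z ≡ false) → ω ≐ reverseCut U ω
  reverseCut-identity U≡false a b rewrite U≡false a | U≡false b = refl

minimumOn : ∀ {n} (h : Fin n → ℕ) {U : Fin n → Bool} {m₀} → U m₀ ≡ true →
            ∃ λ m → U m ≡ true × (∀ {z} → U z ≡ true → h m ≤ h z)
minimumOn h {U} Um₀ = go _ ℕ.≤-refl Um₀
  where
  go : ∀ k {m₀} → h m₀ ≤ k → U m₀ ≡ true →
       ∃ λ m → U m ≡ true × (∀ {z} → U z ≡ true → h m ≤ h z)
  go k {m₀} hm₀≤k Um₀ with any? (λ z → (U z 𝔹.≟ true) ×-dec (h z ℕ.<? h m₀))
  go k       hm₀≤k Um₀ | no  none          = _ , Um₀ , λ Uz → ℕ.≮⇒≥ λ lt → none (_ , Uz , lt)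
  go zero    hm₀≤k Um₀ | yes (_ , _ , lt)  = contradiction (ℕ.<-≤-trans lt hm₀≤k) ℕ.n≮0
  go (suc k) hm₀≤k Um₀ | yes (_ , Uz , lt) = go k (ℕ.≤-pred (ℕ.<-≤-trans lt hm₀≤k)) Uz

_∖_ : ∀ {n} → (Fin n → Bool) → Fin n → Fin n → Bool
(U ∖ m) z = not (isV m z) ∧ U z

module _ {n} {ω : Orient n} {U : Fin n → Bool} where

  flipAt-reverseCut : ∀ {m} → U m ≡ true → reverseCut (U ∖ m) ω ≐ flipAt m (reverseCut U ω)
  flipAt-reverseCut {m} Um a b with isV m a in ma | isV m b in mb
  ... | false | false = refl
  ... | true  | false rewrite ⌊⌋-sound (a ≟ m) ma | Um with U b
  ...   | true  = refl
  ...   | false = refl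
  flipAt-reverseCut {m} Um a b | false | true rewrite ⌊⌋-sound (b ≟ m) mb | Um with U a
  ...   | true  = refl
  ...   | false = refl
  flipAt-reverseCut {m} Um a b | true | true
    rewrite ⌊⌋-sound (a ≟ m) ma | ⌊⌋-sound (b ≟ m) mb | Um = refl

module _ {n} {ω : Orient n} {h : Fin n → ℕ} (mono : Monotone ω h) where

  reverseCut-∼tor : ∀ U → Upset ω U → ω ∼tor reverseCut U ω
  reverseCut-∼tor U = go _ U ℕ.≤-refl
    where
    go : ∀ k U → count U ≤ k → Upset ω U → ω ∼tor reverseCut U ω
    go k U #U≤k up with any? (λ z → U z 𝔹.≟ true)
    ... | no  U-empty =
      same (reverseCut-identity {ω = ω} {U} λ z → 𝔹.¬-not λ Uz → U-empty (z , Uz))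
    ... | yes (_ , Um₀) with minimumOn h {U} Um₀
    go zero    U #U≤k up | yes _ | m , Um , _ =
      contradiction (ℕ.<-≤-trans (count-nonempty {f = U} Um) #U≤k) ℕ.n≮0
    go (suc k) U #U≤k up | yes _ | m , Um , m-min =
      trans (go k (U ∖ m) #U∖m≤k up∖m)
            (sym (flip (m , m-source , flipAt-reverseCut {ω = ω} {U} Um)))
      where
      no-arrow-into-m : ∀ {a} → U a ≡ true → ¬ Arrow ω a m
      no-arrow-into-m Ua a→m = ℕ.<⇒≱ (mono a→m) (m-min Ua)
      m-source : IsSource (reverseCut U ω) m
      m-source = reverseCut-minimal-source {ω = ω} {U} up Um
                   λ Ua → 𝔹.¬-not (no-arrow-into-m Ua)
      up∖m : Upset ω (U ∖ m)
      up∖m {a} {b} a→b U∖m-a with b ≟ m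
      ... | yes refl = contradiction a→b (no-arrow-into-m (𝔹.∧-conicalʳ _ _ U∖m-a))
      ... | no  _    = up a→b (𝔹.∧-conicalʳ _ _ U∖m-a)
      m∉U∖m : (U ∖ m) m ≡ false
      m∉U∖m rewrite ⌊⌋-true (m ≟ m) refl = refl
      #U∖m≤k : count (U ∖ m) ≤ k
      #U∖m≤k = ℕ.≤-pred (ℕ.<-≤-trans #U∖m<#U #U≤k)
        where #U∖m<#U = count-mono-< {f = U ∖ m} {U} {m} (𝔹.∧-conicalʳ _ _) m∉U∖m Um

reverseCut-monotone : ∀ {n} {ω : Orient n} {U h M} →
                      Monotone ω h → (∀ w → h w < M) → Upset ω U →
                      Monotone (reverseCut U ω) (λ w → h w + (if U w then 0 else M))
reverseCut-monotone {ω = ω} {U} {h} {M} mono h<M up {a} {b} = lift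
  where
  lift : (if U a xor U b then ω b a else ω a b) ≡ true →
         h a + (if U a then 0 else M) < h b + (if U b then 0 else M)
  lift e with U a in Ua | U b in Ub
  ... | true  | true  = ℕ.+-monoˡ-< 0 (mono e)
  ... | false | false = ℕ.+-monoˡ-< M (mono e)
  ... | true  | false =
    ℕ.<-≤-trans (subst (_< M) (≡.sym (ℕ.+-identityʳ (h a))) (h<M a)) (ℕ.m≤n+m M (h b))
  ... | false | true  = contradiction (up e Ub) (𝔹.not-¬ Ua)

module ReverseAbove {n} {G : Graph n} {ω : Orient n} (ori : IsOrientation G ω) (acy : Acyclic ω)
                    (u : Fin n) where
  open Heights acy

  ωᵘ : Orient n
  ωᵘ = reverseCut (u ≤ᵇ_) ω

  orientation : IsOrientation G ωᵘ
  orientation = reverseCut-orientation (u ≤ᵇ_) ori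

  toric : ω ∼tor ωᵘ
  toric = reverseCut-∼tor depth-monotone (u ≤ᵇ_) (≤ᵇ-upset u)

  acyclic : Acyclic ωᵘ
  acyclic = monotone⇒acyclic
    (reverseCut-monotone {U = u ≤ᵇ_} depth-monotone
                         (λ w → s≤s (height-≤ _ w)) (≤ᵇ-upset u))

  source : IsSource ωᵘ u
  source = reverseCut-minimal-source {ω = ω} {u ≤ᵇ_} (≤ᵇ-upset u) (≤ᵇ-complete ε)
             λ u≤a → 𝔹.¬-not λ a→u → acy _ _ a→u (≤ᵇ-sound u≤a)

-- r v is the net number of times v is turned from a source into a sink between ω₁ and ω₂.
FlipCount : ∀ {n} → Orient n → Orient n → Set
FlipCount {n} ω₁ ω₂ = Σ (Fin n → ℤ) λ r → ∀ {a b} → Arrow ω₁ a b →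
  (Arrow ω₂ a b × r a ≡ r b) ⊎ (Arrow ω₂ b a × r a ≡ 1ℤ ℤ.+ r b)

private
  neg-shift : ∀ x → ℤ.- x ≡ 1ℤ ℤ.+ ℤ.- (1ℤ ℤ.+ x)
  neg-shift = solve-∀
  +-shiftʳ : ∀ x y → x ℤ.+ (1ℤ ℤ.+ y) ≡ 1ℤ ℤ.+ (x ℤ.+ y)
  +-shiftʳ = solve-∀
  +-shiftˡ : ∀ x y → (1ℤ ℤ.+ x) ℤ.+ y ≡ 1ℤ ℤ.+ (x ℤ.+ y)
  +-shiftˡ = solve-∀
  +-shift : ∀ x y → (1ℤ ℤ.+ x) ℤ.+ y ≡ x ℤ.+ (1ℤ ℤ.+ y)
  +-shift = solve-∀

flipCount-refl : ∀ {n} {ω : Orient n} → FlipCount ω ω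
flipCount-refl = (λ _ → 0ℤ) , λ a→b → inj₁ (a→b , refl)

flipCount-cong : ∀ {n} {ω₁ ω₂ ω₂′ : Orient n} → ω₂ ≐ ω₂′ → FlipCount ω₁ ω₂ → FlipCount ω₁ ω₂′
flipCount-cong ω₂≐ (r , rule) = r , λ {a} {b} a→b →
  Data.Sum.map (map₁ (≡.trans (≡.sym (ω₂≐ a b))))
               (map₁ (≡.trans (≡.sym (ω₂≐ b a)))) (rule a→b)

flipCount-trans : ∀ {n} {ω₁ ω₂ ω₃ : Orient n} →
                  FlipCount ω₁ ω₂ → FlipCount ω₂ ω₃ → FlipCount ω₁ ω₃
flipCount-trans {n} {ω₁} {ω₂} {ω₃} (r₁ , rule₁) (r₂ , rule₂) = r , rule
  where
  r : Fin n → ℤ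
  r w = r₁ w ℤ.+ r₂ w
  rule : ∀ {a b} → Arrow ω₁ a b →
         (Arrow ω₃ a b × r a ≡ r b) ⊎ (Arrow ω₃ b a × r a ≡ 1ℤ ℤ.+ r b)
  rule {a} {b} a→b with rule₁ a→b
  ... | inj₁ (a→b′ , q₁) with rule₂ a→b′
  ...   | inj₁ (a→b″ , q₂) = inj₁ (a→b″ , cong₂ ℤ._+_ q₁ q₂)
  ...   | inj₂ (b→a″ , q₂) =
    inj₂ (b→a″ , ≡.trans (cong₂ ℤ._+_ q₁ q₂) (+-shiftʳ (r₁ b) (r₂ b)))
  rule {a} {b} a→b | inj₂ (b→a′ , q₁) with rule₂ b→a′
  ...   | inj₁ (b→a″ , q₂) =
    inj₂ (b→a″ , ≡.trans (cong₂ ℤ._+_ q₁ (≡.sym q₂)) (+-shiftˡ (r₁ b) (r₂ b)))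
  ...   | inj₂ (a→b″ , q₂) = inj₁ (a→b″ , r-equal)
    where
    open ≡.≡-Reasoning
    r-equal : r a ≡ r b
    r-equal = begin
      r₁ a ℤ.+ r₂ a            ≡⟨ cong (λ x → x ℤ.+ r₂ a) q₁ ⟩
      (1ℤ ℤ.+ r₁ b) ℤ.+ r₂ a   ≡⟨ +-shift (r₁ b) (r₂ a) ⟩
      r₁ b ℤ.+ (1ℤ ℤ.+ r₂ a)   ≡⟨ cong (λ x → r₁ b ℤ.+ x) q₂ ⟨
      r₁ b ℤ.+ r₂ b            ∎

module _ {n} (G : Graph n) where

  flipAt-flipCount : ∀ {ω} → IsOrientation G ω → ∀ {v} → IsSource ω v →
                     FlipCount ω (flipAt v ω)
  flipAt-flipCount {ω} o {v} source = r , rule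
    where
    open IsOrientation o
    r : Fin n → ℤ
    r w = if isV v w then 1ℤ else 0ℤ
    rule : ∀ {a b} → ω a b ≡ true →
      ((if isV v a ∨ isV v b then ω b a else ω a b) ≡ true ×
         (if isV v a then 1ℤ else 0ℤ) ≡ (if isV v b then 1ℤ else 0ℤ)) ⊎
      ((if isV v b ∨ isV v a then ω a b else ω b a) ≡ true ×
         (if isV v a then 1ℤ else 0ℤ) ≡ 1ℤ ℤ.+ (if isV v b then 1ℤ else 0ℤ))
    rule {a} {b} a→b with isV v a in va | isV v b in vb
    ... | true  | true  rewrite ⌊⌋-sound (a ≟ v) va | ⌊⌋-sound (b ≟ v) vb =
      contradiction (on-edges v v a→b) (𝔹.not-¬ (irrefl G v))
    ... | true  | false = inj₂ (a→b , refl)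
    ... | false | true  rewrite ⌊⌋-sound (b ≟ v) vb =
      contradiction a→b (𝔹.not-¬ (source a))
    ... | false | false = inj₁ (a→b , refl)

  flipCount-sym : ∀ {ω₁ ω₂} → IsOrientation G ω₁ → IsOrientation G ω₂ →
                  FlipCount ω₂ ω₁ → FlipCount ω₁ ω₂
  flipCount-sym {ω₁} {ω₂} o₁ o₂ (r , rule) = (ℤ.-_ ∘ r) , rule′
    where
    open IsOrientation
    rule′ : ∀ {a b} → Arrow ω₁ a b →
            (Arrow ω₂ a b × ℤ.- r a ≡ ℤ.- r b) ⊎
            (Arrow ω₂ b a × ℤ.- r a ≡ 1ℤ ℤ.+ ℤ.- r b)
    rule′ {a} {b} a→b with total o₂ a b (on-edges o₁ a b a→b)
    ... | inj₁ a→₂b with rule a→₂b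
    ...   | inj₁ (_ , ra≡rb)   = inj₁ (a→₂b , cong ℤ.-_ ra≡rb)
    ...   | inj₂ (b→a , _)     = contradiction b→a (𝔹.not-¬ (antisym o₁ a b a→b))
    rule′ {a} {b} a→b | inj₂ b→₂a with rule b→₂a
    ...   | inj₁ (b→a , _)     = contradiction b→a (𝔹.not-¬ (antisym o₁ a b a→b))
    ...   | inj₂ (_ , rb≡1+ra) =
      inj₂ (b→₂a , ≡.trans (neg-shift (r a)) (cong (λ z → 1ℤ ℤ.+ ℤ.- z) (≡.sym rb≡1+ra)))

  ∼tor⇒flipCount : ∀ {ω₁ ω₂} → IsOrientation G ω₁ → ω₁ ∼tor ω₂ → FlipCount ω₁ ω₂
  ∼tor⇒flipCount o₁ (same ω₁≐ω₂) = flipCount-cong ω₁≐ω₂ flipCount-refl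
  ∼tor⇒flipCount o₁ (flip (v , source , ω₂≐)) =
    flipCount-cong (λ a b → ≡.sym (ω₂≐ a b)) (flipAt-flipCount o₁ source)
  ∼tor⇒flipCount o₁ (sym p) = flipCount-sym o₁ o₂ (∼tor⇒flipCount o₂ p)
    where o₂ = Equivalence.from (∼tor-orientation G p) o₁
  ∼tor⇒flipCount o₁ (trans p q) = flipCount-trans (∼tor⇒flipCount o₁ p) (∼tor⇒flipCount o₂ q)
    where o₂ = Equivalence.to (∼tor-orientation G p) o₁

fromℚᵘ-mono-< : ∀ {p q} → p ℚᵘ.< q → ℚ.fromℚᵘ p ℚ.< ℚ.fromℚᵘ q
fromℚᵘ-mono-< {p} {q} p<q = ℚ.toℚᵘ-cancel-< (ℚᵘ.<-respˡ-≃ (ℚᵘ.≃-sym (ℚ.toℚᵘ-fromℚᵘ p))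
                                             (ℚᵘ.<-respʳ-≃ (ℚᵘ.≃-sym (ℚ.toℚᵘ-fromℚᵘ q)) p<q))

fromℚᵘ-mono-≤ : ∀ {p q} → p ℚᵘ.≤ q → ℚ.fromℚᵘ p ℚ.≤ ℚ.fromℚᵘ q
fromℚᵘ-mono-≤ {p} {q} p≤q = ℚ.toℚᵘ-cancel-≤ (ℚᵘ.≤-respˡ-≃ (ℚᵘ.≃-sym (ℚ.toℚᵘ-fromℚᵘ p))
                                             (ℚᵘ.≤-respʳ-≃ (ℚᵘ.≃-sym (ℚ.toℚᵘ-fromℚᵘ q)) p≤q))

-- ratio d a = a / (d + 1): the second field of mkℚᵘ is the denominator minus one.
opaque
  ratio : ℕ → ℕ → ℚ
  ratio d a = ℚ.fromℚᵘ (ℚᵘ.mkℚᵘ (+ a) d)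

  ratio-< : ∀ d {a b} → a < b → ratio d a ℚ.< ratio d b
  ratio-< d {a} {b} a<b = fromℚᵘ-mono-< {ℚᵘ.mkℚᵘ (+ a) d} {ℚᵘ.mkℚᵘ (+ b) d}
    (ℚᵘ.*<* (ℤ.+◃-mono-< (ℕ.*-monoˡ-< (suc d) a<b)))

  ratio-<1 : ∀ d {a} → a ≤ d → ratio d a ℚ.< 1ℚ
  ratio-<1 d {a} a≤d = fromℚᵘ-mono-< {ℚᵘ.mkℚᵘ (+ a) d} {ℚᵘ.mkℚᵘ (+ 1) 0}
    (ℚᵘ.*<* (ℤ.+◃-mono-< a*1<1*[1+d]))
    where
    a*1<1*[1+d] : a ℕ.* 1 < 1 ℕ.* suc d
    a*1<1*[1+d] rewrite ℕ.*-identityʳ a | ℕ.*-identityˡ (suc d) = s≤s a≤d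

  0≤ratio : ∀ d a → 0ℚ ℚ.≤ ratio d a
  0≤ratio d a = fromℚᵘ-mono-≤ {ℚᵘ.mkℚᵘ (+ 0) 0} {ℚᵘ.mkℚᵘ (+ a) d}
    (ℚᵘ.*≤* (subst (+ 0 ℤ.≤_) (≡.sym (ℤ.+◃n≡+n (a ℕ.* 1))) (ℤ.+≤+ z≤n)))

module _ {n} {G : Graph n} {ω′ : Orient n} (o′ : IsOrientation G ω′) {x : Fin n → ℚ}
         (increasing : ∀ {a b} → Arrow ω′ a b → x a ℚ.< x b) where
  open IsOrientation o′

  orientOf-≐ : orientOf G x ≐ ω′
  orientOf-≐ a b = agrees
    where
    agrees : (adj G a b ∧ ⌊ x a ℚ.<? x b ⌋) ≡ ω′ a b
    agrees with ω′ a b in a→b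
    ... | true rewrite on-edges a b a→b = ⌊⌋-true (x a ℚ.<? x b) (increasing a→b)
    ... | false with adj G a b in ab
    ...   | false = refl
    ...   | true with total a b ab
    ...     | inj₁ a→b′ = contradiction a→b′ (𝔹.not-¬ a→b)
    ...     | inj₂ b→a  = ⌊⌋-false (x a ℚ.<? x b) (ℚ.<-asym (increasing b→a))

  adjacent-distinct : ∀ a b → adj G a b ≡ true → x a ≢ x b
  adjacent-distinct a b ab xa≡xb with total a b ab
  ... | inj₁ a→b = ℚ.<-irrefl xa≡xb (increasing a→b)
  ... | inj₂ b→a = ℚ.<-irrefl (≡.sym xa≡xb) (increasing b→a)

monotone⇒inChamber : ∀ {n} {G : Graph n} {ω ω′ : Orient n} → IsOrientation G ω′ → ω′ ∼tor ω →
                     ∀ {f d} → Monotone ω′ f → (∀ w → f w ≤ d) → InChamber G ω (ratio d ∘ f)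
monotone⇒inChamber {G = G} {ω′ = ω′} o′ ω′∼ω {f} {d} mono f≤d =
  (λ a → 0≤ratio d (f a) , ratio-<1 d (f≤d a)) ,
  adjacent-distinct o′ increasing ,
  trans (same (orientOf-≐ o′ increasing)) ω′∼ω
  where
  increasing : ∀ {a b} → Arrow ω′ a b → ratio d (f a) ℚ.< ratio d (f b)
  increasing a→b = ratio-< d (mono a→b)

Increasing : ∀ {n} → (Fin n → ℚ) → List (Fin n) → Set
Increasing x = Linked (λ a b → x a ℚ.< x b)

CyclicallyIncreasing : ∀ {n} → (Fin n → ℚ) → List (Fin n) → Set
CyclicallyIncreasing x l = Σ ℕ λ k → Increasing x (rotate k l)

rotate-↭ : ∀ {A : Set} k (l : List A) → rotate k l ↭ l
rotate-↭ k l = ↭.↭-trans (↭.++-comm (drop k l) (take k l)) (↭.↭-reflexive (take++drop≡id k l))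

∈-rotate : ∀ {A : Set} {a : A} k {l} → a ∈ l → a ∈ rotate k l
∈-rotate k {l} = ↭.∈-resp-↭ (↭.↭-sym (rotate-↭ k l))

pattern 1st = here refl
pattern 2nd = there (here refl)
pattern 3rd = there (there (here refl))

increasing-injective : ∀ {n} {x : Fin n → ℚ} {l a b} →
                       Increasing x l → a ∈ l → b ∈ l → x a ≡ x b → a ≡ b
increasing-injective {x = x} inc = go (Linked⇒AllPairs ℚ.<-trans inc)
  where
  go : ∀ {l a b} → AllPairs (λ u v → x u ℚ.< x v) l → a ∈ l → b ∈ l → x a ≡ x b → a ≡ b
  go _           (here refl) (here refl) _     = refl
  go (a<l ∷ _)   (here refl) (there b∈l) xa≡xb = ⊥-elim (ℚ.<⇒≢ (All.lookup a<l b∈l) xa≡xb)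
  go (b<l ∷ _)   (there a∈l) (here refl) xa≡xb = ⊥-elim (ℚ.<⇒≢ (All.lookup b<l a∈l) (≡.sym xa≡xb))
  go (_ ∷ pairs) (there a∈l) (there b∈l) xa≡xb = go pairs a∈l b∈l xa≡xb

commonChain⇒distinct : ∀ {n} {G : Graph n} {ω x} → InChamber G ω x →
                       ∀ {i j} → CommonChain G ω i j → x i ≡ x j → i ≡ j
commonChain⇒distinct x∈c (l , _ , i∈l , j∈l , cyc) xi≡xj with cyc _ x∈c
... | k , inc = increasing-injective inc (∈-rotate k i∈l) (∈-rotate k j∈l) xi≡xj

CyclicTriple : ∀ {n} → (Fin n → ℚ) → Fin n → Fin n → Fin n → Set
CyclicTriple x a b c =
  (x a ℚ.< x b × x b ℚ.< x c) ⊎ (x b ℚ.< x c × x c ℚ.< x a) ⊎ (x c ℚ.< x a × x a ℚ.< x b)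

rotate-3+ : ∀ {A : Set} t (a b c : A) → rotate (3 + t) (a ∷ b ∷ c ∷ []) ≡ a ∷ b ∷ c ∷ []
rotate-3+ {A} t a b c rewrite drop-[] {A = A} t | take-[] {A = A} t = refl

cyclicallyIncreasing⇒cyclicTriple : ∀ {n} {x : Fin n → ℚ} {a b c} →
  CyclicallyIncreasing x (a ∷ b ∷ c ∷ []) → CyclicTriple x a b c
cyclicallyIncreasing⇒cyclicTriple (0 , p ∷ q ∷ [-]) = inj₁ (p , q)
cyclicallyIncreasing⇒cyclicTriple (1 , p ∷ q ∷ [-]) = inj₂ (inj₁ (p , q))
cyclicallyIncreasing⇒cyclicTriple (2 , p ∷ q ∷ [-]) = inj₂ (inj₂ (p , q))
cyclicallyIncreasing⇒cyclicTriple {x = x} {a} {b} {c} (suc (suc (suc t)) , inc)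
  with subst (Increasing x) (rotate-3+ t a b c) inc
... | p ∷ q ∷ [-] = inj₁ (p , q)

cyclicTriple-asym : ∀ {n} {x : Fin n → ℚ} {a b c} → CyclicTriple x a b c → ¬ CyclicTriple x a c b
cyclicTriple-asym (inj₁ (_ , b<c))        (inj₁ (_ , c<b))        = ℚ.<-asym b<c c<b
cyclicTriple-asym (inj₁ (a<b , _))        (inj₂ (inj₁ (_ , b<a))) = ℚ.<-asym a<b b<a
cyclicTriple-asym (inj₁ (a<b , _))        (inj₂ (inj₂ (b<a , _))) = ℚ.<-asym a<b b<a
cyclicTriple-asym (inj₂ (inj₁ (b<c , _))) (inj₁ (_ , c<b))        = ℚ.<-asym b<c c<b
cyclicTriple-asym (inj₂ (inj₁ (b<c , _))) (inj₂ (inj₁ (c<b , _))) = ℚ.<-asym b<c c<b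
cyclicTriple-asym (inj₂ (inj₁ (_ , c<a))) (inj₂ (inj₂ (_ , a<c))) = ℚ.<-asym c<a a<c
cyclicTriple-asym (inj₂ (inj₂ (c<a , _))) (inj₁ (a<c , _))        = ℚ.<-asym c<a a<c
cyclicTriple-asym (inj₂ (inj₂ (_ , a<b))) (inj₂ (inj₁ (_ , b<a))) = ℚ.<-asym a<b b<a
cyclicTriple-asym (inj₂ (inj₂ (_ , a<b))) (inj₂ (inj₂ (b<a , _))) = ℚ.<-asym a<b b<a

-- For x with values in [0, 1) these are the orders K a < K b and K a < K b + 1 of the lifts
-- K = x − r to ℚ, written without arithmetic.
module LiftedOrder {n} (x : Fin n → ℚ) (r : Fin n → ℤ) where

  _≺_ : Fin n → Fin n → Set
  a ≺ b = r b ℤ.< r a ⊎ (r a ≡ r b × x a ℚ.< x b)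

  _≺₁_ : Fin n → Fin n → Set
  a ≺₁ b = r b ℤ.≤ r a ⊎ (r b ≡ 1ℤ ℤ.+ r a × x a ℚ.< x b)

  ≺-trans : ∀ {a b c} → a ≺ b → b ≺ c → a ≺ c
  ≺-trans (inj₁ rb<ra) (inj₁ rc<rb) = inj₁ (ℤ.<-trans rc<rb rb<ra)
  ≺-trans {a} (inj₁ rb<ra) (inj₂ (rb≡rc , _)) = inj₁ (subst (ℤ._< r a) rb≡rc rb<ra)
  ≺-trans {c = c} (inj₂ (ra≡rb , _)) (inj₁ rc<rb) = inj₁ (subst (r c ℤ.<_) (≡.sym ra≡rb) rc<rb)
  ≺-trans (inj₂ (ra≡rb , a<b)) (inj₂ (rb≡rc , b<c)) =
    inj₂ (≡.trans ra≡rb rb≡rc , ℚ.<-trans a<b b<c)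

  ≺-≺₁-trans : ∀ {a b c} → a ≺ b → b ≺₁ c → a ≺₁ c
  ≺-≺₁-trans (inj₁ rb<ra) (inj₁ rc≤rb) = inj₁ (ℤ.≤-trans rc≤rb (ℤ.<⇒≤ rb<ra))
  ≺-≺₁-trans {a} (inj₁ rb<ra) (inj₂ (rc≡1+rb , _)) =
    inj₁ (subst (ℤ._≤ r a) (≡.sym rc≡1+rb) (ℤ.i<j⇒suc[i]≤j rb<ra))
  ≺-≺₁-trans {c = c} (inj₂ (ra≡rb , _)) (inj₁ rc≤rb) = inj₁ (subst (r c ℤ.≤_) (≡.sym ra≡rb) rc≤rb)
  ≺-≺₁-trans (inj₂ (ra≡rb , a<b)) (inj₂ (rc≡1+rb , b<c)) =
    inj₂ (≡.trans rc≡1+rb (cong (λ z → 1ℤ ℤ.+ z) (≡.sym ra≡rb)) , ℚ.<-trans a<b b<c)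

  cyclic-pair : ∀ {i j} → i ≺ j → j ≺₁ i → CyclicallyIncreasing x (i ∷ j ∷ [])
  cyclic-pair (inj₁ rj<ri)       (inj₁ ri≤rj)         = contradiction ri≤rj (ℤ.<⇒≱ rj<ri)
  cyclic-pair (inj₁ _)           (inj₂ (_ , j<i))     = 1 , j<i ∷ [-]
  cyclic-pair (inj₂ (_ , i<j))   (inj₁ _)             = 0 , i<j ∷ [-]
  cyclic-pair (inj₂ (ri≡rj , _)) (inj₂ (ri≡1+rj , _)) =
    contradiction (≡.trans (≡.sym ri≡rj) ri≡1+rj) ℤ.i≢suc[i]

  cyclic-triple : ∀ {i k j} → i ≺ k → k ≺ j → j ≺₁ i →
                  CyclicallyIncreasing x (i ∷ k ∷ j ∷ [])
  cyclic-triple (inj₂ (_ , i<k)) (inj₂ (_ , k<j)) (inj₁ _)         = 0 , i<k ∷ k<j ∷ [-]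
  cyclic-triple (inj₁ _)         (inj₂ (_ , k<j)) (inj₂ (_ , j<i)) = 1 , k<j ∷ j<i ∷ [-]
  cyclic-triple (inj₂ (_ , i<k)) (inj₁ _)         (inj₂ (_ , j<i)) = 2 , j<i ∷ i<k ∷ [-]
  cyclic-triple (inj₂ (ri≡rk , _)) (inj₂ (rk≡rj , _)) (inj₂ (ri≡1+rj , _)) =
    contradiction (≡.trans (≡.sym (≡.trans ri≡rk rk≡rj)) ri≡1+rj) ℤ.i≢suc[i]
  cyclic-triple (inj₁ rk<ri) (inj₁ rj<rk) (inj₁ ri≤rj) =
    contradiction ri≤rj (ℤ.<⇒≱ (ℤ.<-trans rj<rk rk<ri))
  cyclic-triple {i} (inj₁ rk<ri) (inj₂ (rk≡rj , _)) (inj₁ ri≤rj) =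
    contradiction ri≤rj (ℤ.<⇒≱ (subst (ℤ._< r i) rk≡rj rk<ri))
  cyclic-triple {k = k} (inj₁ rk<ri) (inj₁ rj<rk) (inj₂ (ri≡1+rj , _)) =
    contradiction (subst (ℤ._≤ r k) (≡.sym ri≡1+rj) (ℤ.i<j⇒suc[i]≤j rj<rk)) (ℤ.<⇒≱ rk<ri)
  cyclic-triple {j = j} (inj₂ (ri≡rk , _)) (inj₁ rj<rk) (inj₁ ri≤rj) =
    contradiction ri≤rj (ℤ.<⇒≱ (subst (r j ℤ.<_) (≡.sym ri≡rk) rj<rk))

module ChamberLift {n} {G : Graph n} {ω ω′ : Orient n} (o′ : IsOrientation G ω′)
                   (ω′∼ω : ω′ ∼tor ω) {x : Fin n → ℚ} (x∈c : InChamber G ω x) where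

  flipCount : FlipCount ω′ (orientOf G x)
  flipCount = ∼tor⇒flipCount G o′ (trans ω′∼ω (sym (proj₂ (proj₂ x∈c))))

  open LiftedOrder x (proj₁ flipCount) public

  orientOf-< : ∀ {a b} → Arrow (orientOf G x) a b → x a ℚ.< x b
  orientOf-< {a} {b} a→b = ⌊⌋-sound (x a ℚ.<? x b) (𝔹.∧-conicalʳ _ _ a→b)

  arrow-≺ : ∀ {a b} → Arrow ω′ a b → a ≺ b
  arrow-≺ a→b with proj₂ flipCount a→b
  ... | inj₁ (a→b′ , ra≡rb)   = inj₂ (ra≡rb , orientOf-< a→b′)
  ... | inj₂ (_ , ra≡1+rb)    = inj₁ (subst (_ ℤ.<_) (≡.sym ra≡1+rb) (ℤ.suc[i]≤j⇒i<j ℤ.≤-refl))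

  arrow-≺₁ : ∀ {a b} → Arrow ω′ a b → b ≺₁ a
  arrow-≺₁ a→b with proj₂ flipCount a→b
  ... | inj₁ (_ , ra≡rb)       = inj₁ (ℤ.≤-reflexive ra≡rb)
  ... | inj₂ (b→a , ra≡1+rb)   = inj₂ (ra≡1+rb , orientOf-< b→a)

  path-≡⊎≺ : ∀ {a b} → Le ω′ a b → a ≡ b ⊎ a ≺ b
  path-≡⊎≺ ε = inj₁ refl
  path-≡⊎≺ (a→c ◅ c≤b) with path-≡⊎≺ c≤b
  ... | inj₁ refl = inj₂ (arrow-≺ a→c)
  ... | inj₂ c≺b  = inj₂ (≺-trans (arrow-≺ a→c) c≺b)

  path-≺ : ∀ {a b} → Le ω′ a b → a ≢ b → a ≺ b
  path-≺ a≤b a≢b with path-≡⊎≺ a≤b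
  ... | inj₁ a≡b = contradiction a≡b a≢b
  ... | inj₂ a≺b = a≺b

  path-closing : ∀ {i j b} → Le ω′ j b → Arrow ω′ i b → j ≺₁ i
  path-closing j≤b i→b with path-≡⊎≺ j≤b
  ... | inj₁ refl = arrow-≺₁ i→b
  ... | inj₂ j≺b  = ≺-≺₁-trans j≺b (arrow-≺₁ i→b)

module _ {n} {G : Graph n} {ω ω′ : Orient n} (o′ : IsOrientation G ω′) (ω′∼ω : ω′ ∼tor ω)
         {i j b : Fin n} (i→b : Arrow ω′ i b) (j≤b : Le ω′ j b) where

  interval⇒cycOrd-pair : Le ω′ i j → i ≢ j → CycOrd G ω (i ∷ j ∷ [])
  interval⇒cycOrd-pair i≤j i≢j _ x∈c = cyclic-pair (path-≺ i≤j i≢j) (path-closing j≤b i→b)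
    where open ChamberLift o′ ω′∼ω x∈c

  interval⇒cycOrd : ∀ {k} → Le ω′ i k → Le ω′ k j → i ≢ k → k ≢ j →
                    CycOrd G ω (i ∷ k ∷ j ∷ [])
  interval⇒cycOrd i≤k k≤j i≢k k≢j _ x∈c =
    cyclic-triple (path-≺ i≤k i≢k) (path-≺ k≤j k≢j) (path-closing j≤b i→b)
    where open ChamberLift o′ ω′∼ω x∈c

module Peaks {n} {G : Graph n} {ω ω′ : Orient n} (o′ : IsOrientation G ω′)
             (acy′ : Acyclic ω′) (ω′∼ω : ω′ ∼tor ω) where
  open Heights acy′
  open Reachability ω′ using (Le?)

  peak : Fin n → Fin n → ℕ
  peak u = raiseAbove u n depth

  peak-monotone : ∀ u → Monotone ω′ (peak u)
  peak-monotone u = raiseAbove-monotone u n depth-monotone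

  peak-low : ∀ {u v} → ¬ Le ω′ u v → peak u v ≤ n
  peak-low {u} {v} u≰v =
    subst (_≤ n) (≡.sym (raiseAbove-notAbove {depth} n u≰v)) (height-≤ _ v)

  peak-high : ∀ u → n < peak u u
  peak-high u = subst (n <_) (≡.sym (raiseAbove-above {depth} n ε))
                  (ℕ.+-monoˡ-< n (depth-positive u))

  peakPoint : Fin n → Fin n → ℚ
  peakPoint u = ratio (n + n) ∘ peak u

  peakPoint-inChamber : ∀ u → InChamber G ω (peakPoint u)
  peakPoint-inChamber u =
    monotone⇒inChamber o′ ω′∼ω (peak-monotone u) (raiseAbove-≤ {depth} u n (height-≤ _))

  peakPoint-increasing : ∀ u {a b} → Le ω′ a b → a ≢ b → peakPoint u a ℚ.< peakPoint u b
  peakPoint-increasing u a≤b a≢b = ratio-< (n + n) (monotone-< (peak-monotone u) a≤b a≢b)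

  peakPoint-peak : ∀ {u v} → ¬ Le ω′ u v → peakPoint u v ℚ.< peakPoint u u
  peakPoint-peak {u} u≰v = ratio-< (n + n) (ℕ.≤-<-trans (peak-low u≰v) (peak-high u))

  cyclicTriple-at : ∀ {a b c} → CycOrd G ω (a ∷ b ∷ c ∷ []) → ∀ u →
                    CyclicTriple (peakPoint u) a b c
  cyclicTriple-at cyc u = cyclicallyIncreasing⇒cyclicTriple (cyc _ (peakPoint-inChamber u))

  cycOrd⇒interval : ∀ {i j k} → Le ω′ i j → i ≢ j → CycOrd G ω (i ∷ k ∷ j ∷ []) →
                    Le ω′ i k × Le ω′ k j
  cycOrd⇒interval {i} {j} {k} i≤j i≢j cyc with Le? acy′ i k | Le? acy′ k j
  ... | yes i≤k | yes k≤j = i≤k , k≤j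
  ... | no  i≰k | _       = ⊥-elim (cyclicTriple-asym {x = peakPoint i}
        (inj₂ (inj₂ (peakPoint-peak i≰k , peakPoint-increasing i i≤j i≢j))) (cyclicTriple-at cyc i))
  ... | yes _   | no  k≰j = ⊥-elim (cyclicTriple-asym {x = peakPoint k}
        (inj₁ (peakPoint-increasing k i≤j i≢j , peakPoint-peak k≰j)) (cyclicTriple-at cyc k))

module _ {n} {G : Graph n} {ω ω′ : Orient n} (o′ : IsOrientation G ω′) (acy′ : Acyclic ω′)
         (ω′∼ω : ω′ ∼tor ω) {i} (source : IsSource ω′ i) where
  open Heights acy′

  source-≰⇒¬commonChain : ∀ {j} → ¬ Le ω′ i j → ¬ CommonChain G ω i j
  source-≰⇒¬commonChain {j} i≰j chain = i≰j (subst (Le ω′ i) i≡j ε)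
    where
    S : Fin n → Bool
    S z = not (isV i z)
    head∈S : ∀ {a b} → Arrow ω′ a b → not ⌊ b ≟ i ⌋ ≡ true
    head∈S {a} {b} a→b with b ≟ i
    ... | yes refl = contradiction a→b (𝔹.not-¬ (source a))
    ... | no  _    = refl
    nothing-below-i : ∀ z → (z ≤ᵇ i ∧ not ⌊ z ≟ i ⌋) ≡ false
    nothing-below-i z with z ≤ᵇ i in z≤i
    ... | false = refl
    ... | true rewrite source-minimal source (≤ᵇ-sound z≤i) =
      cong not (⌊⌋-true (i ≟ i) refl)
    c : ℕ
    c = height S j
    f : Fin n → ℕ
    f = raiseAbove i c (height S)
    x∈c : InChamber G ω (ratio (n + c) ∘ f)
    x∈c = monotone⇒inChamber o′ ω′∼ω (raiseAbove-monotone i c (height-monotone head∈S))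
                                      (raiseAbove-≤ {height S} i c (height-≤ S))
    fi≡fj : f i ≡ f j
    fi≡fj = begin
      f i              ≡⟨ raiseAbove-above {height S} c ε ⟩
      height S i + c   ≡⟨ cong (_+ c) (count-empty {f = λ z → z ≤ᵇ i ∧ S z} nothing-below-i) ⟩
      c                ≡⟨ raiseAbove-notAbove {height S} c i≰j ⟨
      f j              ∎
      where open ≡.≡-Reasoning
    i≡j : i ≡ j
    i≡j = commonChain⇒distinct {G = G} x∈c chain (cong (ratio (n + c)) fi≡fj)

module _ {n} {G : Graph n} {ω : Orient n} {I : Fin n → Set} {i j : Fin n}
         (I-tor : IsTorInterval G ω I i j) where

  diagonal-isInterval : Acyclic ω → i ≡ j → IsInterval ω I i j
  diagonal-isInterval acy refl k = mk⇔ to from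
    where
    to : I k → InInterval ω i i k
    to Ik with Equivalence.to (I-tor k) Ik
    ... | inj₁ (_ , refl) = ε , ε
    ... | inj₂ (i≢i , _)  = contradiction refl i≢i
    from : InInterval ω i i k → I k
    from (i≤k , k≤i) = Equivalence.from (I-tor k) (inj₁ (refl , acyclic-antisym acy k≤i i≤k))

  source-isInterval : ∀ {ω′} → IsOrientation G ω′ → Acyclic ω′ → ω′ ∼tor ω →
                      IsSource ω′ i → ¬ Le ω′ i j → IsInterval ω′ I i j
  source-isInterval {ω′} o′ acy′ ω′∼ω source i≰j k =
    mk⇔ to (λ (i≤k , k≤j) → contradiction (i≤k ◅◅ k≤j) i≰j)
    where
    to : I k → InInterval ω′ i j k
    to Ik with Equivalence.to (I-tor k) Ik
    ... | inj₁ (refl , _)     = contradiction ε i≰j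
    ... | inj₂ (_ , chain , _) = ⊥-elim (source-≰⇒¬commonChain o′ acy′ ω′∼ω source i≰j chain)

  closingArrow-isInterval : ∀ {ω′ b} → IsOrientation G ω′ → Acyclic ω′ → ω′ ∼tor ω →
                            Le ω′ i j → i ≢ j → Arrow ω′ i b → Le ω′ j b → IsInterval ω′ I i j
  closingArrow-isInterval {ω′} o′ acy′ ω′∼ω i≤j i≢j i→b j≤b k = mk⇔ to from
    where
    to : I k → InInterval ω′ i j k
    to Ik with Equivalence.to (I-tor k) Ik
    ... | inj₁ (i≡j , _)                         = contradiction i≡j i≢j
    ... | inj₂ (_ , _ , inj₁ refl)               = ε , i≤j
    ... | inj₂ (_ , _ , inj₂ (inj₁ refl))        = i≤j , ε
    ... | inj₂ (_ , _ , inj₂ (inj₂ (_ , _ , cyc))) =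
      Peaks.cycOrd⇒interval o′ acy′ ω′∼ω i≤j i≢j cyc
    chain : CommonChain G ω i j
    chain = i ∷ j ∷ [] , (i≢j All.∷ All.[]) ∷ All.[] ∷ [] , 1st , 2nd ,
            interval⇒cycOrd-pair o′ ω′∼ω i→b j≤b i≤j i≢j
    from : InInterval ω′ i j k → I k
    from (i≤k , k≤j) = Equivalence.from (I-tor k) (inj₂ (i≢j , chain , position))
      where
      position : k ≡ i ⊎ k ≡ j ⊎ (k ≢ i × k ≢ j × CycOrd G ω (i ∷ k ∷ j ∷ []))
      position with k ≟ i | k ≟ j
      ... | yes k≡i | _       = inj₁ k≡i
      ... | no  _   | yes k≡j = inj₂ (inj₁ k≡j)
      ... | no  k≢i | no  k≢j = inj₂ (inj₂ (k≢i , k≢j ,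
              interval⇒cycOrd o′ ω′∼ω i→b j≤b i≤k k≤j (k≢i ∘ ≡.sym) k≢j))

IntervalInClass : ∀ {n} → Graph n → Orient n → (Fin n → Set) → Fin n → Fin n → Set
IntervalInClass {n} G ω I i j =
  Σ (Orient n) λ ω′ → IsOrientation G ω′ × Acyclic ω′ × ω′ ∼tor ω × IsInterval ω′ I i j

module _ {n} {G : Graph n} {ω : Orient n} {I : Fin n → Set} {i j : Fin n}
         (I-tor : IsTorInterval G ω I i j) where

  source⇒interval : ∀ {ω₀} → IsOrientation G ω₀ → Acyclic ω₀ → ω₀ ∼tor ω → IsSource ω₀ i →
                    i ≢ j → IntervalInClass G ω I i j
  source⇒interval {ω₀} o₀ acy₀ ω₀∼ω source i≢j with Reachability.Le? ω₀ acy₀ i j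
  ... | no i≰j = ω₀ , o₀ , acy₀ , ω₀∼ω , source-isInterval I-tor o₀ acy₀ ω₀∼ω source i≰j
  ... | yes i≤j with any? (λ b → (ω₀ i b 𝔹.≟ true) ×-dec Reachability.Le? ω₀ acy₀ j b)
  ...   | yes (b , i→b , j≤b) =
    ω₀ , o₀ , acy₀ , ω₀∼ω , closingArrow-isInterval I-tor o₀ acy₀ ω₀∼ω i≤j i≢j i→b j≤b
  ...   | no  no-closing-arrow =
    R.ωᵘ , R.orientation , R.acyclic , trans (sym R.toric) ω₀∼ω ,
    source-isInterval I-tor R.orientation R.acyclic (trans (sym R.toric) ω₀∼ω) i-source i≰j
    where
    module R = ReverseAbove o₀ acy₀ j
    open Heights acy₀ using (_≤ᵇ_; ≤ᵇ-false)
    i-source : IsSource R.ωᵘ i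
    i-source = reverseCut-source {ω = ω₀} {j ≤ᵇ_} source
                 (≤ᵇ-false λ j≤i → i≢j (≡.sym (source-minimal source j≤i)))
                 (λ i→b → ≤ᵇ-false λ j≤b → no-closing-arrow (_ , i→b , j≤b))
    i≰j : ¬ Le R.ωᵘ i j
    i≰j i≤j′ = i≢j (source-minimal R.source i≤j′)

torInterval⇒interval : ∀ {n} {G : Graph n} {ω : Orient n} → IsOrientation G ω → Acyclic ω →
                       ∀ {I i j} → IsTorInterval G ω I i j → IntervalInClass G ω I i j
torInterval⇒interval {G = G} {ω} o acy {i = i} {j} I-tor with i ≟ j
... | yes i≡j = ω , o , acy , same (λ _ _ → refl) , diagonal-isInterval {G = G} I-tor acy i≡j
... | no  i≢j = source⇒interval {G = G} I-tor R.orientation R.acyclic (sym R.toric) R.source i≢j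
  where module R = ReverseAbove o acy i

decide₁ : ∀ {n} {P : Fin n → Set} (P? : ∀ a → Dec (P a)) → True (all? P?) → ∀ a → P a
decide₁ P? = toWitness

decide₂ : ∀ {n} {P : Fin n → Fin n → Set} (P? : ∀ a b → Dec (P a b)) →
          True (all? λ a → all? (P? a)) → ∀ a b → P a b
decide₂ P? = toWitness

pattern 𝟘 = zero
pattern 𝟙 = suc zero
pattern 𝟚 = suc (suc zero)

adj₃ : Fin 3 → Fin 3 → Bool
adj₃ 𝟘 𝟙 = true
adj₃ 𝟙 𝟘 = true
adj₃ 𝟙 𝟚 = true
adj₃ 𝟚 𝟙 = true
adj₃ _ _ = false

path₃ : Graph 3
path₃ = record
  { adj     = adj₃
  ; adj-sym = decide₂ (λ a b → adj₃ a b 𝔹.≟ adj₃ b a) _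
  ; irrefl  = decide₁ (λ a → adj₃ a a 𝔹.≟ false) _
  }

ω₃ : Orient 3
ω₃ 𝟘 𝟙 = true
ω₃ 𝟙 𝟚 = true
ω₃ _ _ = false

ω₃-orientation : IsOrientation path₃ ω₃
ω₃-orientation = record
  { on-edges = decide₂ (λ a b → (ω₃ a b 𝔹.≟ true) →-dec (adj₃ a b 𝔹.≟ true)) _
  ; total    = decide₂ (λ a b → (adj₃ a b 𝔹.≟ true) →-dec
                                  ((ω₃ a b 𝔹.≟ true) ⊎-dec (ω₃ b a 𝔹.≟ true))) _
  ; antisym  = decide₂ (λ a b → (ω₃ a b 𝔹.≟ true) →-dec (ω₃ b a 𝔹.≟ false)) _
  }

ω₃-acyclic : Acyclic ω₃
ω₃-acyclic = monotone⇒acyclic λ {a} {b} →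
  decide₂ (λ a b → (ω₃ a b 𝔹.≟ true) →-dec (F.toℕ a ℕ.<? F.toℕ b)) _ a b

x₃ : Fin 3 → ℚ
x₃ 𝟙 = ℚ.½
x₃ _ = 0ℚ

x₃∈chamber : InChamber path₃ ω₃ x₃
x₃∈chamber =
  decide₁ (λ a → (0ℚ ℚ.≤? x₃ a) ×-dec (x₃ a ℚ.<? 1ℚ)) _ ,
  decide₂ (λ a b → (adj₃ a b 𝔹.≟ true) →-dec ¬? (x₃ a ℚ.≟ x₃ b)) _ ,
  flip (𝟚 , decide₁ (λ a → orientOf path₃ x₃ a 𝟚 𝔹.≟ false) _ ,
            decide₂ (λ a b → ω₃ a b 𝔹.≟ flipAt 𝟚 (orientOf path₃ x₃) a b) _)

no-chain-through-𝟘-𝟚 : ∀ {l} → 𝟘 ∈ l → 𝟚 ∈ l → ¬ CycOrd path₃ ω₃ l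
no-chain-through-𝟘-𝟚 {l} 𝟘∈l 𝟚∈l cyc with cyc x₃ x₃∈chamber
... | k , inc with increasing-injective inc (∈-rotate k 𝟘∈l) (∈-rotate k 𝟚∈l) refl
... | ()

𝟘≤𝟙 : Le ω₃ 𝟘 𝟙
𝟘≤𝟙 = refl ◅ ε

𝟙≤𝟚 : Le ω₃ 𝟙 𝟚
𝟙≤𝟚 = refl ◅ ε

everything-between-𝟘-𝟚 : ∀ k → InInterval ω₃ 𝟘 𝟚 k
everything-between-𝟘-𝟚 𝟘 = ε , 𝟘≤𝟙 ◅◅ 𝟙≤𝟚
everything-between-𝟘-𝟚 𝟙 = 𝟘≤𝟙 , 𝟙≤𝟚
everything-between-𝟘-𝟚 𝟚 = 𝟘≤𝟙 ◅◅ 𝟙≤𝟚 , ε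

interval-not-torInterval :
  ¬ (Σ (Fin 3) λ i → Σ (Fin 3) λ j → IsTorInterval path₃ ω₃ (InInterval ω₃ 𝟘 𝟚) i j)
interval-not-torInterval (i , j , V-tor) = separate (member 𝟘) (member 𝟚)
  where
  member : ∀ k → InTorInterval path₃ ω₃ i j k
  member k = Equivalence.to (V-tor k) (everything-between-𝟘-𝟚 k)
  separate : InTorInterval path₃ ω₃ i j 𝟘 → InTorInterval path₃ ω₃ i j 𝟚 → ⊥
  separate (inj₁ (_ , refl)) (inj₁ (_ , ()))
  separate (inj₁ (i≡j , _))  (inj₂ (i≢j , _)) = i≢j i≡j
  separate (inj₂ (i≢j , _))  (inj₁ (i≡j , _)) = i≢j i≡j
  separate (inj₂ (_ , (l , _ , i∈l , j∈l , cyc) , 𝟘-at)) (inj₂ (i≢j , _ , 𝟚-at)) with 𝟘-at | 𝟚-at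
  ... | inj₁ refl               | inj₂ (inj₁ refl)        = no-chain-through-𝟘-𝟚 i∈l j∈l cyc
  ... | inj₂ (inj₁ refl)        | inj₁ refl               = no-chain-through-𝟘-𝟚 j∈l i∈l cyc
  ... | inj₁ refl               | inj₂ (inj₂ (_ , _ , c)) = no-chain-through-𝟘-𝟚 1st 2nd c
  ... | inj₂ (inj₁ refl)        | inj₂ (inj₂ (_ , _ , c)) = no-chain-through-𝟘-𝟚 3rd 2nd c
  ... | inj₂ (inj₂ (_ , _ , c)) | inj₁ refl               = no-chain-through-𝟘-𝟚 2nd 1st c
  ... | inj₂ (inj₂ (_ , _ , c)) | inj₂ (inj₁ refl)        = no-chain-through-𝟘-𝟚 2nd 3rd c
  ... | inj₂ (inj₂ (0≢i , 0≢j , _)) | inj₂ (inj₂ (2≢i , 2≢j , _)) =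
    i≢j (≡.trans (only-𝟙 0≢i 2≢i) (≡.sym (only-𝟙 0≢j 2≢j)))
    where
    only-𝟙 : ∀ {v : Fin 3} → 𝟘 ≢ v → 𝟚 ≢ v → v ≡ 𝟙
    only-𝟙 {𝟘} 0≢0 _ = contradiction refl 0≢0
    only-𝟙 {𝟙} _ _ = refl
    only-𝟙 {𝟚} _ 2≢2 = contradiction refl 2≢2

proposition5p14 :
    ((n : ℕ) (G : Graph n) (ω : Orient n) → IsOrientation G ω → Acyclic ω →
      (I : Fin n → Set) (i j : Fin n) → IsTorInterval G ω I i j →
      Σ (Orient n) λ ω' → IsOrientation G ω' × Acyclic ω' × ω' ∼tor ω × IsInterval ω' I i j)
    ×
    (Σ ℕ λ n → Σ (Graph n) λ G → Σ (Orient n) λ ω → Σ (Orient n) λ ω' →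
      Σ (Fin n) λ i → Σ (Fin n) λ j →
      IsOrientation G ω × Acyclic ω × IsOrientation G ω' × Acyclic ω' × ω' ∼tor ω ×
      ¬ (Σ (Fin n) λ i' → Σ (Fin n) λ j' →
           IsTorInterval G ω (InInterval ω' i j) i' j'))
proposition5p14 =
  (λ n G ω o acy I i j I-tor → torInterval⇒interval o acy I-tor) ,
  (3 , path₃ , ω₃ , ω₃ , 𝟘 , 𝟚 , ω₃-orientation , ω₃-acyclic , ω₃-orientation , ω₃-acyclic ,
   same (λ _ _ → refl) , interval-not-torInterval)
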